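{- Suppose $s$ and $l$ are nonnegative integers and $b$ is a positive integer. Then $\tau_s(s+2,b) \geq l$ whenever $b \geq \binom{l+s+1}{l}(l+s+1)^{s+1}$.
   Context: All graphs are finite and simple. For graphs $G,H$ on disjoint vertex sets, the join $G \vee H$ is the graph consisting of $G$, $H$, and all edges joining a vertex of $G$ to a vertex of $H$; $K_n$ is the complete graph on $n$ vertices, and $K_0 \vee G$ is understood as $G$. $K_{a,b}$ is the complete bipartite graph with partite sets of sizes $a$ and $b$. $\chi$ denotes chromatic number and $\chi_\ell$ list chromatic number. For a nonnegative integer $s$ and positive integers $a,b$, $\tau_s(a,b)$ denotes the smallest nonnegative integer $n$ such that $\chi_\ell(K_n \vee K_{a,b}) - \chi(K_n \vee K_{a,b}) \leq s$. -}

module Defs where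

open import Data.Nat using (ℕ; _≤_; _<_; _∸_; _+_; _*_; _^_)
open import Data.Fin using (Fin)
open import Data.Sum using (_⊎_; inj₁; inj₂)
open import Data.Product using (Σ; _×_; ∃)
open import Data.Unit using (⊤)
open import Data.Empty using (⊥)
open import Data.List using (List; length)
open import Data.List.Membership.Propositional using (_∈_)
open import Data.List.Relation.Unary.Unique.Propositional using (Unique)
open import Relation.Binary.PropositionalEquality using (_≡_; _≢_)
open import Relation.Nullary using (¬_)

-- A (finite, simple) graph: a vertex type and an adjacency relation.
-- All graphs constructed below have vertex type built from Fin, ⊎,
-- and symmetric irreflexive adjacency.
record Graph : Set₁ where
  field
    V : Set
    E : V → V → Set
open Graph public

K : ℕ → Graph
K n = record { V = Fin n ; E = λ u v → u ≢ v }

bipE : {a b : ℕ} → Fin a ⊎ Fin b → Fin a ⊎ Fin b → Set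
bipE (inj₁ _) (inj₂ _) = ⊤
bipE (inj₂ _) (inj₁ _) = ⊤
bipE _ _ = ⊥

Kbip : ℕ → ℕ → Graph
Kbip a b = record { V = Fin a ⊎ Fin b ; E = bipE }

joinE : (G H : Graph) → V G ⊎ V H → V G ⊎ V H → Set
joinE G H (inj₁ u) (inj₁ v) = E G u v
joinE G H (inj₂ u) (inj₂ v) = E H u v
joinE G H _ _ = ⊤

_∨ᵍ_ : Graph → Graph → Graph
G ∨ᵍ H = record { V = V G ⊎ V H ; E = joinE G H }

Colourable : Graph → ℕ → Set
Colourable G k = Σ (V G → Fin k) λ c → ∀ u v → E G u v → c u ≢ c v

IsChromaticNumber : Graph → ℕ → Set
IsChromaticNumber G k = Colourable G k × (∀ j → j < k → ¬ Colourable G j)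

Choosable : Graph → ℕ → Set
Choosable G k =
  (L : V G → List ℕ) →
  (∀ v → Unique (L v)) →
  (∀ v → k ≤ length (L v)) →
  Σ (V G → ℕ) λ f → (∀ v → f v ∈ L v) × (∀ u v → E G u v → f u ≢ f v)

IsListChromaticNumber : Graph → ℕ → Set
IsListChromaticNumber G k = Choosable G k × (∀ j → j < k → ¬ Choosable G j)

DiffAtMost : Graph → ℕ → Set
DiffAtMost G s = ∃ λ c → ∃ λ d →
  IsChromaticNumber G c × IsListChromaticNumber G d × (d ∸ c ≤ s)

IsTau : ℕ → ℕ → ℕ → ℕ → Set
IsTau s a b t =
  DiffAtMost (K t ∨ᵍ Kbip a b) s × (∀ n → n < t → ¬ DiffAtMost (K n ∨ᵍ Kbip a b) s)

-- Let t < l and k = t + s + 2; since χ(K_t ∨ K_{s+2,b}) ≤ t + 2 it suffices to show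
-- that this graph is not k-choosable. Colours are pairs (block, digit) with s + 2 blocks
-- of k digits. The clique K_t and the last vertex of the (s+2)-side take their lists
-- from the last block, so in any colouring these t + 1 pairwise adjacent vertices use a
-- (t+1)-subset D of that block; the other s + 1 vertices of that side get one block each
-- and pick a digit h_j in it. The b ≥ C(k, t+1) k^(s+1) vertices of the other side
-- enumerate all pairs (D, h), the vertex of (D, h) receiving the list D ∪ {(j, h_j)}
-- of size k, all of whose colours are taken by its neighbours.
module Submission where

open import Defs
open import Data.Nat using (ℕ; _≤_; _+_; _*_; _^_; suc)
open import Data.Nat.Combinatorics using (_C_)

open import Data.Nat using (_∸_; _≤?_; _≤′_; ≤′-refl; ≤′-step)
open import Data.Nat.Properties
  using (≤-refl; ≤-trans; ≤-reflexive; ≮⇒≥; ≰⇒>; ≤⇒≤′; m≤m+n; m≤n+m∸n; m+[n∸m]≡n;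
         +-mono-≤; +-monoˡ-≤; *-mono-≤; ^-monoˡ-≤; +-assoc; +-comm; +-suc)
open import Data.Nat.Combinatorics using (nCk+nC[k+1]≡[n+1]C[k+1])
open import Data.Fin as Fin
  using (Fin; toℕ; fromℕ; inject₁; punchIn; punchOut; join; splitAt; combine; remQuot;
         finToFun; funToFin; _↑ˡ_)
open import Data.Fin.Properties
  using (any?; suc-injective; toℕ-injective; inject₁-injective; fromℕ≢inject₁; punchIn-injective;
         punchInᵢ≢i; punchOut-injective; punchIn-punchOut; splitAt-join; splitAt-↑ˡ;
         combine-injective; remQuot-combine; finToFun-funToFin)
open import Data.List using (List; []; _∷_; _++_; map; tabulate; allFin; length; lookup)
open import Data.List.Properties using (length-map; length-++; length-tabulate; tabulate-cong)
open import Data.List.Relation.Unary.All as All using (All; []; _∷_)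
import Data.List.Relation.Unary.All.Properties as All
open import Data.List.Relation.Unary.Any using (here; index)
open import Data.List.Relation.Unary.Any.Properties using (lookup-index)
open import Data.List.Relation.Unary.AllPairs using ([]; _∷_)
open import Data.List.Relation.Unary.Unique.Propositional using (Unique)
import Data.List.Relation.Unary.Unique.Propositional.Properties as Unique
open import Data.List.Membership.Propositional using (_∈_; _∉_)
open import Data.List.Membership.Propositional.Properties
  using (∈-map⁺; ∈-map⁻; ∈-++⁺ˡ; ∈-++⁺ʳ; ∈-tabulate⁻; ∈-lookup)
open import Data.Product using (∃; _×_; _,_; proj₁; proj₂)
open import Data.Sum as Sum using (inj₁; inj₂)
open import Data.Sum.Properties using (inj₁-injective; inj₂-injective)
open import Data.Unit using (tt)
open import Data.Empty using (⊥)
open import Function using (id; _∘_; const; case_of_)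
open import Function.Definitions using (Injective)
open import Relation.Nullary using (¬_; yes; no; contradiction)
open import Relation.Binary.PropositionalEquality
  using (_≡_; _≢_; _≗_; refl; sym; trans; cong; cong₂; subst; module ≡-Reasoning)

Proper : (G : Graph) → (V G → ℕ) → Set
Proper G f = ∀ u v → E G u v → f u ≢ f v

Choosable-mono : ∀ {G d e} → d ≤ e → Choosable G d → Choosable G e
Choosable-mono d≤e choose L unique long = choose L unique (λ v → ≤-trans d≤e (long v))

DiffAtMost⇒Choosable : ∀ {G s c} → DiffAtMost G s → Colourable G c → Choosable G (c + s)
DiffAtMost⇒Choosable {c = c} (χ , χℓ , (_ , below-χ) , (choosable , _) , χℓ∸χ≤s) colourable =
  Choosable-mono (≤-trans (m≤n+m∸n χℓ χ) (+-mono-≤ χ≤c χℓ∸χ≤s)) choosable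
  where
  χ≤c : χ ≤ c
  χ≤c = ≮⇒≥ (λ c<χ → below-χ c c<χ colourable)

K-colourable : ∀ n → Colourable (K n) n
K-colourable n = id , λ _ _ u≢v → u≢v

Kbip-colourable : ∀ a b → Colourable (Kbip a b) 2
Kbip-colourable a b = side , proper
  where
  side : V (Kbip a b) → Fin 2
  side (inj₁ _) = Fin.zero
  side (inj₂ _) = Fin.suc Fin.zero
  proper : ∀ u v → E (Kbip a b) u v → side u ≢ side v
  proper (inj₁ _) (inj₂ _) _ ()
  proper (inj₂ _) (inj₁ _) _ ()

join-injective : ∀ m n → Injective _≡_ _≡_ (join m n)
join-injective m n {x} {y} eq =
  trans (sym (splitAt-join m n x)) (trans (cong (splitAt m) eq) (splitAt-join m n y))

∨ᵍ-colourable : ∀ {G H m n} → Colourable G m → Colourable H n → Colourable (G ∨ᵍ H) (m + n)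
∨ᵍ-colourable {G} {H} {m} {n} (c , c-proper) (d , d-proper) = colour , proper
  where
  colour : V (G ∨ᵍ H) → Fin (m + n)
  colour = join m n ∘ Sum.map c d
  colour-injective : ∀ u v → colour u ≡ colour v → Sum.map c d u ≡ Sum.map c d v
  colour-injective u v = join-injective m n {Sum.map c d u} {Sum.map c d v}
  proper : ∀ u v → E (G ∨ᵍ H) u v → colour u ≢ colour v
  proper (inj₁ u) (inj₁ v) uv eq =
    c-proper u v uv (inj₁-injective (colour-injective (inj₁ u) (inj₁ v) eq))
  proper (inj₂ u) (inj₂ v) uv eq =
    d-proper u v uv (inj₂-injective (colour-injective (inj₂ u) (inj₂ v) eq))
  proper (inj₁ u) (inj₂ v) _  eq = case colour-injective (inj₁ u) (inj₂ v) eq of λ ()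
  proper (inj₂ u) (inj₁ v) _  eq = case colour-injective (inj₂ u) (inj₁ v) eq of λ ()

UsedByNeighbour : (G : Graph) → (V G → ℕ) → V G → ℕ → Set
UsedByNeighbour G f v x = ∃ λ u → E G v u × f u ≡ x

Proper⇒∉-neighbour-colours : ∀ {G f v xs} → Proper G f →
  All (UsedByNeighbour G f v) xs → f v ∉ xs
Proper⇒∉-neighbour-colours {v = v} proper used fv∈xs =
  let (u , vu , fu≡fv) = All.lookup used fv∈xs in proper v u vu (sym fu≡fv)

DistinctOfLength : ∀ {A : Set} → ℕ → List A → Set
DistinctOfLength r xs = Unique xs × length xs ≡ r

binomial-mono : ∀ c {r r′} → r ≤′ r′ → (r + c) C r ≤ (r′ + c) C r′
binomial-mono c ≤′-refl = ≤-refl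
binomial-mono c (≤′-step {r′} r≤′r′) =
  ≤-trans (binomial-mono c r≤′r′)
          (subst ((r′ + c) C r′ ≤_) (nCk+nC[k+1]≡[n+1]C[k+1] (r′ + c) r′) (m≤m+n _ _))

combinations : ∀ n → ℕ → List (List (Fin n))
combinations n       0       = [] ∷ []
combinations 0       (suc r) = []
combinations (suc n) (suc r) =
  map ((Fin.zero ∷_) ∘ map Fin.suc) (combinations n r) ++ map (map Fin.suc) (combinations n (suc r))

length-combinations : ∀ n r → length (combinations n r) ≡ n C r
length-combinations n       0       = refl
length-combinations 0       (suc r) = refl
length-combinations (suc n) (suc r) = begin
  length (map _ (combinations n r) ++ map _ (combinations n (suc r)))
    ≡⟨ length-++ (map _ (combinations n r)) ⟩
  length (map _ (combinations n r)) + length (map _ (combinations n (suc r)))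
    ≡⟨ cong₂ _+_ (length-map _ (combinations n r)) (length-map _ (combinations n (suc r))) ⟩
  length (combinations n r) + length (combinations n (suc r))
    ≡⟨ cong₂ _+_ (length-combinations n r) (length-combinations n (suc r)) ⟩
  n C r + n C suc r
    ≡⟨ nCk+nC[k+1]≡[n+1]C[k+1] n r ⟩
  suc n C suc r ∎
  where open ≡-Reasoning

combinations-distinct : ∀ n r → All (DistinctOfLength r) (combinations n r)
combinations-distinct n       0       = ([] , refl) ∷ []
combinations-distinct 0       (suc r) = []
combinations-distinct (suc n) (suc r) =
  All.++⁺ (All.map⁺ (All.map zero∷shift (combinations-distinct n r)))
          (All.map⁺ (All.map shift (combinations-distinct n (suc r))))
  where
  shift : ∀ {r′} {D : List (Fin n)} → DistinctOfLength r′ D → DistinctOfLength r′ (map Fin.suc D)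
  shift {D = D} (unique , length≡) =
    Unique.map⁺ suc-injective unique , trans (length-map Fin.suc D) length≡
  zero∷shift : ∀ {D : List (Fin n)} → DistinctOfLength r D →
    DistinctOfLength (suc r) (Fin.zero ∷ map Fin.suc D)
  zero∷shift distinct =
    let (unique , length≡) = shift distinct
    in (All.map⁺ (All.tabulate λ _ ()) ∷ unique) , cong suc length≡

InImage : ∀ {r n} → (Fin r → Fin n) → Fin n → Set
InImage g x = ∃ λ j → g j ≡ x

module _ {r n} (g : Fin r → Fin (suc n)) (avoids-zero : ∀ j → Fin.zero ≢ g j) where

  unsuc : Fin r → Fin n
  unsuc j = punchOut (avoids-zero j)

  suc-unsuc : ∀ j → Fin.suc (unsuc j) ≡ g j
  suc-unsuc j = punchIn-punchOut (avoids-zero j)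

  unsuc-injective : Injective _≡_ _≡_ g → Injective _≡_ _≡_ unsuc
  unsuc-injective g-injective {i} {j} eq =
    g-injective (punchOut-injective (avoids-zero i) (avoids-zero j) eq)

  map-suc-InImage : ∀ {D} → All (InImage unsuc) D → All (InImage g) (map Fin.suc D)
  map-suc-InImage =
    All.map⁺ ∘ All.map (λ (j , eq) → j , trans (sym (suc-unsuc j)) (cong Fin.suc eq))

image-contains-combination : ∀ n r (g : Fin r → Fin n) → Injective _≡_ _≡_ g →
  ∃ λ D → D ∈ combinations n r × All (InImage g) D
image-contains-combination n       0       g _ = [] , here refl , []
image-contains-combination 0       (suc r) g _ = case g Fin.zero of λ ()
image-contains-combination (suc n) (suc r) g g-injective
  with any? (λ j → g j Fin.≟ Fin.zero)
... | yes (j₀ , gj₀≡0) =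
  let (D , D∈ , D⊆) = image-contains-combination n r
                        (unsuc g′ avoids) (unsuc-injective g′ avoids g′-injective)
  in Fin.zero ∷ map Fin.suc D ,
     ∈-++⁺ˡ (∈-map⁺ ((Fin.zero ∷_) ∘ map Fin.suc) D∈) ,
     (j₀ , gj₀≡0) ∷ All.map (λ (j , eq) → punchIn j₀ j , eq) (map-suc-InImage g′ avoids D⊆)
  where
  g′ : Fin r → Fin (suc n)
  g′ = g ∘ punchIn j₀
  g′-injective : Injective _≡_ _≡_ g′
  g′-injective = punchIn-injective j₀ _ _ ∘ g-injective
  avoids : ∀ j → Fin.zero ≢ g′ j
  avoids j 0≡g′j = punchInᵢ≢i j₀ j (g-injective (trans (sym 0≡g′j) (sym gj₀≡0)))
... | no ∄j =
  let (D , D∈ , D⊆) = image-contains-combination n (suc r)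
                        (unsuc g avoids) (unsuc-injective g avoids g-injective)
  in map Fin.suc D , ∈-++⁺ʳ _ (∈-map⁺ (map Fin.suc) D∈) , map-suc-InImage g avoids D⊆
  where
  avoids : ∀ j → Fin.zero ≢ g j
  avoids j 0≡gj = ∄j (j , sym 0≡gj)

module NotChoosable (t a r : ℕ) where

  k : ℕ
  k = suc t + a

  cliques : List (List (Fin k))
  cliques = combinations k (suc t)

  N : ℕ
  N = length cliques * k ^ a

  G : Graph
  G = K t ∨ᵍ Kbip (suc a) (N + r)

  colour : Fin (suc a) → Fin k → ℕ
  colour i d = toℕ (combine i d)

  colour-injective : ∀ i i′ d d′ → colour i d ≡ colour i′ d′ → i ≡ i′ × d ≡ d′
  colour-injective i i′ d d′ = combine-injective i d i′ d′ ∘ toℕ-injective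

  colour-injectiveʳ : ∀ i → Injective _≡_ _≡_ (colour i)
  colour-injectiveʳ i {d} {d′} = proj₂ ∘ colour-injective i i d d′

  palette : Fin (suc a) → List ℕ
  palette i = map (colour i) (allFin k)

  ∈-palette⁻ : ∀ i {x} → x ∈ palette i → ∃ λ d → x ≡ colour i d
  ∈-palette⁻ i x∈ = let (d , _ , x≡) = ∈-map⁻ (colour i) x∈ in d , x≡

  palette-distinct : ∀ i → DistinctOfLength k (palette i)
  palette-distinct i =
    Unique.map⁺ (colour-injectiveʳ i) (Unique.allFin⁺ k) ,
    trans (length-map (colour i) (allFin k)) (length-tabulate id)

  digitColour : (Fin a → Fin k) → Fin a → ℕ
  digitColour h j = colour (inject₁ j) (h j)

  trap : List (Fin k) → (Fin a → Fin k) → List ℕ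
  trap D h = map (colour (fromℕ a)) D ++ tabulate (digitColour h)

  trap-distinct : ∀ {D} h → DistinctOfLength (suc t) D → DistinctOfLength k (trap D h)
  trap-distinct {D} h (unique , length≡) =
    Unique.++⁺ (Unique.map⁺ (colour-injectiveʳ (fromℕ a)) unique)
               (Unique.tabulate⁺ λ {j} {j′} →
                 inject₁-injective ∘ proj₁ ∘ colour-injective (inject₁ j) (inject₁ j′) (h j) (h j′))
               disjoint ,
    (begin
      length (trap D h)
        ≡⟨ length-++ (map (colour (fromℕ a)) D) ⟩
      length (map (colour (fromℕ a)) D) + length (tabulate (digitColour h))
        ≡⟨ cong₂ _+_ (length-map (colour (fromℕ a)) D) (length-tabulate (digitColour h)) ⟩
      length D + a
        ≡⟨ cong (_+ a) length≡ ⟩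
      k ∎)
    where
    open ≡-Reasoning
    disjoint : ∀ {x} → ¬ (x ∈ map (colour (fromℕ a)) D × x ∈ tabulate (digitColour h))
    disjoint (x∈D , x∈h) =
      let (d , _ , x≡) = ∈-map⁻ (colour (fromℕ a)) x∈D ; (j , x≡′) = ∈-tabulate⁻ x∈h
      in fromℕ≢inject₁ (proj₁ (colour-injective (fromℕ a) (inject₁ j) d (h j) (trans (sym x≡) x≡′)))

  trapOf : Fin (length cliques) × Fin (k ^ a) → List ℕ
  trapOf (i , e) = trap (lookup cliques i) (finToFun e)

  trapOf-distinct : ∀ ie → DistinctOfLength k (trapOf ie)
  trapOf-distinct (i , e) =
    trap-distinct (finToFun e) (All.lookup (combinations-distinct k (suc t)) (∈-lookup i))

  -- A vertex w < N of the large side is read as a pair (index of a clique, digit vector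
  -- in base k); the remaining r vertices are surplus and get an arbitrary palette.
  L : V G → List ℕ
  L (inj₁ _)        = palette (fromℕ a)
  L (inj₂ (inj₁ i)) = palette i
  L (inj₂ (inj₂ w)) = Sum.[ trapOf ∘ remQuot (k ^ a) , const (palette Fin.zero) ] (splitAt N w)

  L-distinct : ∀ v → DistinctOfLength k (L v)
  L-distinct (inj₁ _)        = palette-distinct (fromℕ a)
  L-distinct (inj₂ (inj₁ i)) = palette-distinct i
  L-distinct (inj₂ (inj₂ w)) with splitAt N w
  ... | inj₁ w′ = trapOf-distinct (remQuot (k ^ a) w′)
  ... | inj₂ _  = palette-distinct Fin.zero

  trap-cong : ∀ D {h h′} → h ≗ h′ → trap D h ≡ trap D h′
  trap-cong D h≗h′ =
    cong (map (colour (fromℕ a)) D ++_) (tabulate-cong (λ j → cong (colour (inject₁ j)) (h≗h′ j)))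

  module _ (f : V G → ℕ) (f∈L : ∀ v → f v ∈ L v) (proper : Proper G f) where

    clique : Fin (suc t) → V G
    clique Fin.zero    = inj₂ (inj₁ (fromℕ a))
    clique (Fin.suc u) = inj₁ u

    clique-adjacent : ∀ i j → i ≢ j → E G (clique i) (clique j)
    clique-adjacent Fin.zero    Fin.zero    i≢j = i≢j refl
    clique-adjacent Fin.zero    (Fin.suc _) _   = tt
    clique-adjacent (Fin.suc _) Fin.zero    _   = tt
    clique-adjacent (Fin.suc _) (Fin.suc _) i≢j = i≢j ∘ cong Fin.suc

    clique-in-palette : ∀ j → f (clique j) ∈ palette (fromℕ a)
    clique-in-palette Fin.zero    = f∈L (clique Fin.zero)
    clique-in-palette (Fin.suc u) = f∈L (inj₁ u)

    g : Fin (suc t) → Fin k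
    g j = proj₁ (∈-palette⁻ (fromℕ a) (clique-in-palette j))

    g-colour : ∀ j → f (clique j) ≡ colour (fromℕ a) (g j)
    g-colour j = proj₂ (∈-palette⁻ (fromℕ a) (clique-in-palette j))

    g-injective : Injective _≡_ _≡_ g
    g-injective {i} {j} gi≡gj with i Fin.≟ j
    ... | yes i≡j = i≡j
    ... | no  i≢j = contradiction
      (trans (g-colour i) (trans (cong (colour (fromℕ a)) gi≡gj) (sym (g-colour j))))
      (proper (clique i) (clique j) (clique-adjacent i j i≢j))

    side : Fin a → V G
    side j = inj₂ (inj₁ (inject₁ j))

    h : Fin a → Fin k
    h j = proj₁ (∈-palette⁻ (inject₁ j) (f∈L (side j)))

    h-colour : ∀ j → f (side j) ≡ digitColour h j
    h-colour j = proj₂ (∈-palette⁻ (inject₁ j) (f∈L (side j)))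

    covering : ∃ λ D → D ∈ cliques × All (InImage g) D
    covering = image-contains-combination k (suc t) g g-injective

    D : List (Fin k)
    D = proj₁ covering

    D∈cliques : D ∈ cliques
    D∈cliques = proj₁ (proj₂ covering)

    victim : V G
    victim = inj₂ (inj₂ (combine (index D∈cliques) (funToFin h) ↑ˡ r))

    L-victim : L victim ≡ trap D h
    L-victim = begin
      L victim
        ≡⟨ cong Sum.[ trapOf ∘ remQuot (k ^ a) , const (palette Fin.zero) ] (splitAt-↑ˡ N _ r) ⟩
      trapOf (remQuot (k ^ a) (combine (index D∈cliques) (funToFin h)))
        ≡⟨ cong trapOf (remQuot-combine (index D∈cliques) (funToFin h)) ⟩
      trap (lookup cliques (index D∈cliques)) (finToFun (funToFin h))
        ≡⟨ cong (λ D′ → trap D′ (finToFun (funToFin h))) (sym (lookup-index D∈cliques)) ⟩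
      trap D (finToFun (funToFin h))
        ≡⟨ trap-cong D (finToFun-funToFin h) ⟩
      trap D h ∎
      where open ≡-Reasoning

    victim-clique-adjacent : ∀ j → E G victim (clique j)
    victim-clique-adjacent Fin.zero    = tt
    victim-clique-adjacent (Fin.suc _) = tt

    trap-used : All (UsedByNeighbour G f victim) (trap D h)
    trap-used = All.++⁺
      (All.map⁺ (All.map (λ (j , gj≡x) → clique j , victim-clique-adjacent j ,
                                         trans (g-colour j) (cong (colour (fromℕ a)) gj≡x))
                         (proj₂ (proj₂ covering))))
      (All.tabulate⁺ (λ j → side j , tt , h-colour j))

    refute : ⊥
    refute = Proper⇒∉-neighbour-colours proper trap-used (subst (f victim ∈_) L-victim (f∈L victim))

  not-choosable : ¬ Choosable G k
  not-choosable choose =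
    let (f , f∈L , proper) =
          choose L (proj₁ ∘ L-distinct) (λ v → ≤-reflexive (sym (proj₂ (L-distinct v))))
    in refute f f∈L proper

K∨Kbip-not-choosable : ∀ t a b → ((suc t + a) C suc t) * (suc t + a) ^ a ≤ b →
  ¬ Choosable (K t ∨ᵍ Kbip (suc a) b) (suc t + a)
K∨Kbip-not-choosable t a b bound =
  subst (λ b → ¬ Choosable (K t ∨ᵍ Kbip (suc a) b) (suc t + a)) (m+[n∸m]≡n N≤b)
        (NotChoosable.not-choosable t a (b ∸ N))
  where
  N : ℕ
  N = length (combinations (suc t + a) (suc t)) * (suc t + a) ^ a
  N≤b : N ≤ b
  N≤b = subst (λ c → c * (suc t + a) ^ a ≤ b) (sym (length-combinations (suc t + a) (suc t))) bound

count-mono : ∀ c {r r′} → r ≤ r′ → ((r + c) C r) * (r + c) ^ c ≤ ((r′ + c) C r′) * (r′ + c) ^ c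
count-mono c r≤r′ = *-mono-≤ (binomial-mono c (≤⇒≤′ r≤r′)) (^-monoˡ-≤ c (+-monoˡ-≤ c r≤r′))

theorem6 : (s l b : ℕ) → 1 ≤ b →
    ((l + s + 1) C l) * (l + s + 1) ^ (s + 1) ≤ b →
    ∀ t → IsTau s (s + 2) b t → l ≤ t
theorem6 s l b _ bound t (K∨Kbip-diff , _) with l ≤? t
... | yes l≤t = l≤t
... | no  l≰t = contradiction
  (subst (λ a → Choosable (K t ∨ᵍ Kbip a b) (suc t + suc s)) (+-comm s 2) choosable)
  (K∨Kbip-not-choosable t (suc s) b (≤-trans (count-mono (suc s) (≰⇒> l≰t)) bound′))
  where
  bound′ : ((l + suc s) C l) * (l + suc s) ^ suc s ≤ b
  bound′ = subst (λ m → ((l + m) C l) * (l + m) ^ m ≤ b) (+-comm s 1)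
             (subst (λ n → (n C l) * n ^ (s + 1) ≤ b) (+-assoc l s 1) bound)
  choosable : Choosable (K t ∨ᵍ Kbip (s + 2) b) (suc t + suc s)
  choosable = Choosable-mono (≤-reflexive (trans (+-assoc t 2 s) (+-suc t (suc s))))
    (DiffAtMost⇒Choosable K∨Kbip-diff (∨ᵍ-colourable (K-colourable t) (Kbip-colourable (s + 2) b)))
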